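{- Let $k\ge 2$. The correspondence $F(\alpha)\mapsto A(\alpha)$, assigning to each $n$-nest ($\alpha$ ranging over all $k$-germs) its signature, is a bijection from the set of $n$-nests onto the set of their signatures; in particular, distinct $n$-nests have distinct signatures, and $F(\alpha)$ is determined by $A(\alpha)$.
   Context: A $k$-germ ($k\ge 2$) is a string $\alpha=a_{k-1}a_{k-2}\cdots a_1$ of nonnegative integers with $a_{k-1}\in\{0,1\}$ and $0\le a_{i-1}\le a_i+1$ for $1<i<k$. For $\alpha\neq 0^{k-1}$ let $i(\alpha)$ be the index of the rightmost nonzero entry of $\alpha$, and let the parent $\beta$ of $\alpha$ be the $k$-germ equal to $\alpha$ except that $b_{i(\alpha)}=a_{i(\alpha)}-1$; this makes the $k$-germs the nodes of a tree $\mathcal T_k$ rooted at $0^{k-1}$. The $n$-nest $F(\alpha)$ ($n=2k+1$) is defined recursively along $\mathcal T_k$: $F(0^{k-1})=0\,1\,2\cdots(k-1)\,k\,k\,(k-1)\cdots 2\,1$; for $\alpha\ne 0^{k-1}$ with parent $\beta$ and $i=i(\alpha)$, write $F(\beta)=W^i|M|Z^i$ where $W^i$, $Z^i$ are the leftmost and rightmost substrings of length $i$, let $c$ be the leftmost entry of $M$, and split $M=X|Y$ where $Y$ starts at the (leftmost) entry equal to $c+1$ in $M$; then $F(\alpha)=W^i|Y|X|Z^i$. Each $j\in[1,k]$ appears exactly twice in $F(\alpha)$, at positions $p_j<q_j$. The signature of $\alpha$ is $A(\alpha)=(A_{k-1}(\alpha),\dots,A_1(\alpha))$ with $A_j(\alpha)=\lfloor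 (q_j-p_j)/2\rfloor$ (equivalently, the number of integers both of whose appearances lie strictly between the two appearances of $j$ in $F(\alpha)$). -}

module Defs where

open import Data.Nat using (ℕ; zero; suc; _+_; _∸_; _≤_; _/_)
open import Data.Nat.Properties using (_≟_)
open import Data.List using (List; []; _∷_; _++_; length; take; drop; reverse; upTo; map; replicate; downFrom)
open import Data.Product using (_×_)
open import Data.Unit using (⊤)
open import Data.Nat.ListAction using (sum)
open import Relation.Nullary using (yes; no)
open import Relation.Binary.PropositionalEquality using (_≡_)

-- A k-germ a_{k-1} a_{k-2} ... a_1 is represented as the list
-- [a_{k-1}, a_{k-2}, ..., a_1] (leftmost entry = a_{k-1}).

HeadOK : List ℕ → Set
HeadOK []      = ⊤
HeadOK (x ∷ _) = x ≤ 1

Chain : List ℕ → Set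
Chain []            = ⊤
Chain (x ∷ [])      = ⊤
Chain (x ∷ y ∷ r)   = y ≤ suc x × Chain (y ∷ r)

IsGerm : ℕ → List ℕ → Set
IsGerm k α = (length α ≡ k ∸ 1) × HeadOK α × Chain α

-- F(0^{k-1}) = 0 1 2 ... (k-1) k k (k-1) ... 2 1   (length 2k+1)
rootNest : ℕ → List ℕ
rootNest k = upTo (suc k) ++ downFrom' k
  where
  downFrom' : ℕ → List ℕ
  downFrom' zero    = []
  downFrom' (suc m) = suc m ∷ downFrom' m

-- On a reversed germ [a_1, a_2, ..., a_{k-1}]: number of leading zeros,
-- so that i(α) = 1 + leadingZeros (reverse α) when α is nonzero.
leadingZeros : List ℕ → ℕ
leadingZeros []          = 0
leadingZeros (zero ∷ r)  = suc (leadingZeros r)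
leadingZeros (suc _ ∷ _) = 0

decFirst : List ℕ → List ℕ
decFirst []          = []
decFirst (zero ∷ r)  = zero ∷ decFirst r
decFirst (suc a ∷ r) = a ∷ r

parent : List ℕ → List ℕ
parent α = reverse (decFirst (reverse α))

-- index of the rightmost nonzero entry, i(α) (meaningful for α ≠ 0)
rightmostNZ : List ℕ → ℕ
rightmostNZ α = suc (leadingZeros (reverse α))

splitAt≡ : ℕ → List ℕ → List ℕ × List ℕ
splitAt≡ d []      = [] Data.Product., []
splitAt≡ d (x ∷ r) with x ≟ d
... | yes _ = [] Data.Product., (x ∷ r)
... | no _  = let p = splitAt≡ d r in (x ∷ Data.Product.proj₁ p) Data.Product., Data.Product.proj₂ p

-- one step of the construction: from F(β) and i = i(α) produce F(α)
step : ℕ → List ℕ → List ℕ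
step i N =
  let W = take i N
      M = take (length N ∸ (i + i)) (drop i N)
      Z = drop (length N ∸ i) N
      c = headOr0 M
      XY = splitAt≡ (suc c) M
  in W ++ Data.Product.proj₂ XY ++ Data.Product.proj₁ XY ++ Z
  where
  headOr0 : List ℕ → ℕ
  headOr0 []      = 0
  headOr0 (x ∷ _) = x

-- recursion along the tree T_k; the fuel is the entry sum of α,
-- which drops by exactly one when passing to the parent.
nestAux : ℕ → ℕ → List ℕ → List ℕ
nestAux k zero    α = rootNest k
nestAux k (suc f) α = step (rightmostNZ α) (nestAux k f (parent α))

-- the n-nest F(α), n = 2k+1
F : ℕ → List ℕ → List ℕ
F k α = nestAux k (sum α) α

positionsFrom : ℕ → ℕ → List ℕ → List ℕ
positionsFrom j i []      = []
positionsFrom j i (x ∷ r) with x ≟ j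
... | yes _ = i ∷ positionsFrom j (suc i) r
... | no _  = positionsFrom j (suc i) r

sigEntry : List ℕ → ℕ → ℕ
sigEntry N j with positionsFrom j 0 N
... | p ∷ q ∷ _ = (q ∸ p) / 2
... | _         = 0

signature : ℕ → List ℕ → List ℕ
signature k N = map (sigEntry N) (sigIndices (k ∸ 1))
  where
  sigIndices : ℕ → List ℕ
  sigIndices zero    = []
  sigIndices (suc m) = suc m ∷ sigIndices m

-- Each nest met along the way reads 0 1 ⋯ j | forest i forest | i ⋯ 2 1, where a tree rooted at r
-- is written r ⋯ r and every value occurs at most twice. A step at level i moves the last tree
-- behind the middle copy of i to the front of the middle part, so the distance A_i between the two
-- copies of i drops with every step, while A_l for l > i is unchanged: the two exchanged blocks
-- each contain l an even number of times. Reading the germ from a_(k-1) down to a_1, A_i therefore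
-- determines a_i once the higher entries are fixed, and the signature determines the germ.

module Submission where

open import Defs
open import Data.Nat using (ℕ; zero; suc; _+_; _*_; _∸_; _≤_; _<_; z≤n; s≤s; _/_)
open import Data.Nat.Properties
open import Data.Nat.Divisibility using (_∣_; _∣0; ∣m∣n⇒∣m+n; n∣m*n; ∣⇒≤)
open import Data.Nat.DivMod using (m/n≡1+[m∸n]/n)
open import Data.Nat.GeneralisedArithmetic using (fold; fold-+)
open import Data.Nat.ListAction using (sum)
open import Data.Nat.ListAction.Properties using (sum-++)
open import Data.Nat.Solver using (module +-*-Solver)
open import Data.List using (List; []; _∷_; _++_; _∷ʳ_; length; take; drop; reverse; upTo; map; replicate; initLast; _∷ʳ′_)
open import Data.List.Properties
  using (map-++; ++-assoc; ++-identityʳ; ++-cancelˡ; length-++; length-++-comm; upTo-∷ʳ; length-upTo;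
         reverse-++; unfold-reverse; reverse-involutive; ∷-injective; ∷-injectiveˡ; ∷ʳ-injective)
open import Data.Product using (_×_; _,_; proj₁; proj₂)
open import Data.Sum using (_⊎_; inj₁; inj₂)
open import Data.Empty using (⊥-elim)
open import Data.Unit using (⊤)
open import Relation.Nullary using (Dec; yes; no)
open import Relation.Binary.Definitions using (tri<; tri≈; tri>)
open import Relation.Binary.PropositionalEquality
open import Function using (_∘_)

open +-*-Solver using (solve; _:+_; _:*_; _:=_; con)

occurrences : ℕ → List ℕ → ℕ
occurrences j []       = 0
occurrences j (x ∷ xs) with x ≟ j
... | yes _ = suc (occurrences j xs)
... | no  _ = occurrences j xs

occurrences-here : ∀ j xs → occurrences j (j ∷ xs) ≡ suc (occurrences j xs)
occurrences-here j xs with j ≟ j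
... | yes _   = refl
... | no  j≢j = ⊥-elim (j≢j refl)

occurrences-there : ∀ {j x} xs → x ≢ j → occurrences j (x ∷ xs) ≡ occurrences j xs
occurrences-there {j} {x} xs x≢j with x ≟ j
... | yes x≡j = ⊥-elim (x≢j x≡j)
... | no  _   = refl

occurrences-++ : ∀ j xs ys → occurrences j (xs ++ ys) ≡ occurrences j xs + occurrences j ys
occurrences-++ j []       ys = refl
occurrences-++ j (x ∷ xs) ys with x ≟ j
... | yes _ = cong suc (occurrences-++ j xs ys)
... | no  _ = occurrences-++ j xs ys

occurrences-++-absent⁻ : ∀ j xs ys → occurrences j (xs ++ ys) ≡ 0 → occurrences j xs ≡ 0 × occurrences j ys ≡ 0
occurrences-++-absent⁻ j xs ys eq = m+n≡0⇒m≡0 _ eq′ , m+n≡0⇒n≡0 (occurrences j xs) eq′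
  where eq′ = trans (sym (occurrences-++ j xs ys)) eq

occurrences-++-absent⁺ : ∀ j xs ys → occurrences j xs ≡ 0 → occurrences j ys ≡ 0 → occurrences j (xs ++ ys) ≡ 0
occurrences-++-absent⁺ j xs ys xs-absent ys-absent = trans (occurrences-++ j xs ys) (cong₂ _+_ xs-absent ys-absent)

occurrences-swap : ∀ j W X Y Z → occurrences j (W ++ (Y ++ X) ++ Z) ≡ occurrences j (W ++ (X ++ Y) ++ Z)
occurrences-swap j W X Y Z = begin
  occurrences j (W ++ (Y ++ X) ++ Z)                           ≡⟨ occurrences-++ j W _ ⟩
  occurrences j W + occurrences j ((Y ++ X) ++ Z)              ≡⟨ cong (occurrences j W +_) (occurrences-++ j (Y ++ X) Z) ⟩
  occurrences j W + (occurrences j (Y ++ X) + occurrences j Z) ≡⟨ cong (λ n → occurrences j W + (n + occurrences j Z)) YX≡XY ⟩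
  occurrences j W + (occurrences j (X ++ Y) + occurrences j Z) ≡⟨ cong (occurrences j W +_) (occurrences-++ j (X ++ Y) Z) ⟨
  occurrences j W + occurrences j ((X ++ Y) ++ Z)              ≡⟨ occurrences-++ j W _ ⟨
  occurrences j (W ++ (X ++ Y) ++ Z)                           ∎
  where
  open ≡-Reasoning
  YX≡XY : occurrences j (Y ++ X) ≡ occurrences j (X ++ Y)
  YX≡XY = trans (occurrences-++ j Y X) (trans (+-comm (occurrences j Y) _) (sym (occurrences-++ j X Y)))

occurrences-outside : ∀ j U B V → 2 ≤ occurrences j B → occurrences j (U ++ B ++ V) ≤ 2 →
  occurrences j U ≡ 0 × occurrences j V ≡ 0
occurrences-outside j U B V 2≤b bound = m+n≡0⇒m≡0 u u+v≡0 , m+n≡0⇒n≡0 u u+v≡0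
  where
  u = occurrences j U
  b = occurrences j B
  v = occurrences j V
  total : occurrences j (U ++ B ++ V) ≡ b + (u + v)
  total = trans (occurrences-++ j U (B ++ V))
    (trans (cong (u +_) (occurrences-++ j B V))
           (solve 3 (λ u b v → u :+ (b :+ v) := b :+ (u :+ v)) refl u b v))
  u+v≡0 : u + v ≡ 0
  u+v≡0 = n≤0⇒n≡0 (+-cancelˡ-≤ 2 (u + v) 0
    (≤-trans (+-monoˡ-≤ (u + v) 2≤b) (subst (_≤ 2) total bound)))

occurrences-between : ∀ j P Q R → occurrences j (P ++ j ∷ Q ++ j ∷ R) ≤ 2 →
  occurrences j P ≡ 0 × occurrences j Q ≡ 0
occurrences-between j P Q R bound = m+n≡0⇒m≡0 p rest≡0 , m+n≡0⇒m≡0 q (m+n≡0⇒n≡0 p rest≡0)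
  where
  p = occurrences j P
  q = occurrences j Q
  r = occurrences j R
  total : occurrences j (P ++ j ∷ Q ++ j ∷ R) ≡ 2 + (p + (q + r))
  total = begin
    occurrences j (P ++ j ∷ Q ++ j ∷ R)      ≡⟨ occurrences-++ j P _ ⟩
    p + occurrences j (j ∷ Q ++ j ∷ R)        ≡⟨ cong (p +_) (occurrences-here j _) ⟩
    p + suc (occurrences j (Q ++ j ∷ R))      ≡⟨ cong (λ n → p + suc n) (occurrences-++ j Q _) ⟩
    p + suc (q + occurrences j (j ∷ R))       ≡⟨ cong (λ n → p + suc (q + n)) (occurrences-here j R) ⟩
    p + suc (q + suc r)
      ≡⟨ solve 3 (λ p q r → p :+ (con 1 :+ (q :+ (con 1 :+ r))) := con 2 :+ (p :+ (q :+ r))) refl p q r ⟩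
    2 + (p + (q + r))                         ∎
    where open ≡-Reasoning
  rest≡0 : p + (q + r) ≡ 0
  rest≡0 = n≤0⇒n≡0 (+-cancelˡ-≤ 2 (p + (q + r)) 0 (subst (_≤ 2) total bound))

AtMostTwice : List ℕ → Set
AtMostTwice N = ∀ x → occurrences x N ≤ 2

even-zero-or-≥2 : ∀ {n} → 2 ∣ n → n ≡ 0 ⊎ 2 ≤ n
even-zero-or-≥2 {zero}  _   = inj₁ refl
even-zero-or-≥2 {suc _} 2∣n = inj₂ (∣⇒≤ 2∣n)

positionsFrom-++ : ∀ j i xs ys →
  positionsFrom j i (xs ++ ys) ≡ positionsFrom j i xs ++ positionsFrom j (i + length xs) ys
positionsFrom-++ j i []       ys = cong (λ n → positionsFrom j n ys) (sym (+-identityʳ i))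
positionsFrom-++ j i (x ∷ xs) ys rewrite +-suc i (length xs) with x ≟ j
... | yes _ = cong (i ∷_) (positionsFrom-++ j (suc i) xs ys)
... | no  _ = positionsFrom-++ j (suc i) xs ys

positionsFrom-absent : ∀ j i xs → occurrences j xs ≡ 0 → positionsFrom j i xs ≡ []
positionsFrom-absent j i []       _  = refl
positionsFrom-absent j i (x ∷ xs) eq with x ≟ j
positionsFrom-absent j i (x ∷ xs) () | yes _
... | no  _ = positionsFrom-absent j (suc i) xs eq

positionsFrom-here : ∀ j i xs → positionsFrom j i (j ∷ xs) ≡ i ∷ positionsFrom j (suc i) xs
positionsFrom-here j i xs with j ≟ j
... | yes _   = refl
... | no  j≢j = ⊥-elim (j≢j refl)

positionsFrom-shift : ∀ j i d xs → positionsFrom j (i + d) xs ≡ map (_+ d) (positionsFrom j i xs)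
positionsFrom-shift j i d []       = refl
positionsFrom-shift j i d (x ∷ xs) with x ≟ j
... | yes _ = cong (i + d ∷_) (positionsFrom-shift j (suc i) d xs)
... | no  _ = positionsFrom-shift j (suc i) d xs

positionsFrom-skip : ∀ j i A B C → occurrences j B ≡ 0 →
  positionsFrom j i (A ++ B ++ C) ≡ positionsFrom j i A ++ positionsFrom j (i + length A + length B) C
positionsFrom-skip j i A B C absent = begin
  positionsFrom j i (A ++ B ++ C)                                    ≡⟨ positionsFrom-++ j i A _ ⟩
  positionsFrom j i A ++ positionsFrom j (i + length A) (B ++ C)     ≡⟨ cong (positionsFrom j i A ++_) (positionsFrom-++ j _ B C) ⟩
  positionsFrom j i A ++ positionsFrom j (i + length A) B ++ rest
    ≡⟨ cong (λ ps → positionsFrom j i A ++ ps ++ rest) (positionsFrom-absent j _ B absent) ⟩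
  positionsFrom j i A ++ rest                                        ∎
  where
  open ≡-Reasoning
  rest = positionsFrom j (i + length A + length B) C

gap : List ℕ → ℕ
gap (p ∷ q ∷ _) = (q ∸ p) / 2
gap _           = 0

sigEntry≡gap : ∀ N j → sigEntry N j ≡ gap (positionsFrom j 0 N)
sigEntry≡gap N j with positionsFrom j 0 N
... | []        = refl
... | _ ∷ []    = refl
... | _ ∷ _ ∷ _ = refl

gap-shift : ∀ d ps → gap (map (_+ d) ps) ≡ gap ps
gap-shift d []           = refl
gap-shift d (p ∷ [])     = refl
gap-shift d (p ∷ q ∷ ps) = cong (_/ 2) (trans (cong₂ _∸_ (+-comm q d) (+-comm p d)) ([m+n]∸[m+o]≡n∸o d q p))

sigEntry-positions : ∀ N N′ j → positionsFrom j 0 N ≡ positionsFrom j 0 N′ → sigEntry N j ≡ sigEntry N′ j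
sigEntry-positions N N′ j eq = trans (sigEntry≡gap N j) (trans (cong gap eq) (sym (sigEntry≡gap N′ j)))

[1+n+n]/2≡n : ∀ n → suc (n + n) / 2 ≡ n
[1+n+n]/2≡n zero    = refl
[1+n+n]/2≡n (suc n) = trans (m/n≡1+[m∸n]/n {suc (suc n + suc n)} {2} (s≤s (s≤s z≤n)))
  (cong suc (trans (cong (_/ 2) (+-suc n n)) ([1+n+n]/2≡n n)))

sigEntry-between : ∀ j P Q R → occurrences j P ≡ 0 → occurrences j Q ≡ 0 →
  sigEntry (P ++ j ∷ Q ++ j ∷ R) j ≡ suc (length Q) / 2
sigEntry-between j P Q R P-absent Q-absent = begin
  sigEntry (P ++ j ∷ Q ++ j ∷ R) j                     ≡⟨ sigEntry≡gap (P ++ j ∷ Q ++ j ∷ R) j ⟩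
  gap (positionsFrom j 0 (P ++ j ∷ Q ++ j ∷ R))        ≡⟨ cong gap positions ⟩
  gap (p ∷ suc p + length Q ∷ rest)                    ≡⟨ cong (_/ 2) (trans (cong (_∸ p) (sym (+-suc p (length Q)))) (m+n∸m≡n p _)) ⟩
  suc (length Q) / 2                                   ∎
  where
  open ≡-Reasoning
  p = length P
  rest = positionsFrom j (suc (suc p + length Q)) R
  positions : positionsFrom j 0 (P ++ j ∷ Q ++ j ∷ R) ≡ p ∷ suc p + length Q ∷ rest
  positions
    rewrite positionsFrom-++ j 0 P (j ∷ Q ++ j ∷ R) | positionsFrom-absent j 0 P P-absent
          | positionsFrom-here j p (Q ++ j ∷ R)
          | positionsFrom-++ j (suc p) Q (j ∷ R) | positionsFrom-absent j (suc p) Q Q-absent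
          | positionsFrom-here j (suc p + length Q) R
          = refl

sigEntry-block : ∀ j U B V → occurrences j U ≡ 0 → occurrences j V ≡ 0 → sigEntry (U ++ B ++ V) j ≡ sigEntry B j
sigEntry-block j U B V U-absent V-absent = begin
  sigEntry (U ++ B ++ V) j                                   ≡⟨ sigEntry≡gap (U ++ B ++ V) j ⟩
  gap (positionsFrom j 0 (U ++ B ++ V))                      ≡⟨ cong gap positions ⟩
  gap (map (_+ length U) (positionsFrom j 0 B))               ≡⟨ gap-shift (length U) (positionsFrom j 0 B) ⟩
  gap (positionsFrom j 0 B)                                  ≡⟨ sigEntry≡gap B j ⟨
  sigEntry B j                                               ∎
  where
  open ≡-Reasoning
  positions : positionsFrom j 0 (U ++ B ++ V) ≡ map (_+ length U) (positionsFrom j 0 B)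
  positions
    rewrite positionsFrom-++ j 0 U (B ++ V) | positionsFrom-absent j 0 U U-absent
          | positionsFrom-++ j (length U) B V | positionsFrom-absent j (length U + length B) V V-absent
          = trans (++-identityʳ _) (positionsFrom-shift j 0 (length U) B)

sigEntry-swap-holding : ∀ j W X Y Z → 2 ≤ occurrences j X → occurrences j (W ++ (X ++ Y) ++ Z) ≤ 2 →
  sigEntry (W ++ (Y ++ X) ++ Z) j ≡ sigEntry (W ++ (X ++ Y) ++ Z) j
sigEntry-swap-holding j W X Y Z 2≤x bound = begin
  sigEntry (W ++ (Y ++ X) ++ Z) j  ≡⟨ cong (λ N → sigEntry N j) (regroup W Y X Z) ⟩
  sigEntry ((W ++ Y) ++ X ++ Z) j  ≡⟨ sigEntry-block j (W ++ Y) X Z WY-absent Z-absent ⟩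
  sigEntry X j                     ≡⟨ sigEntry-block j W X (Y ++ Z) W-absent YZ-absent ⟨
  sigEntry (W ++ X ++ Y ++ Z) j    ≡⟨ cong (λ N → sigEntry (W ++ N) j) (++-assoc X Y Z) ⟨
  sigEntry (W ++ (X ++ Y) ++ Z) j  ∎
  where
  open ≡-Reasoning
  regroup : ∀ (A B C D : List ℕ) → A ++ (B ++ C) ++ D ≡ (A ++ B) ++ C ++ D
  regroup A B C D = trans (cong (A ++_) (++-assoc B C D)) (sym (++-assoc A B (C ++ D)))
  outside = occurrences-outside j W X (Y ++ Z) 2≤x
              (subst (_≤ 2) (cong (occurrences j) (cong (W ++_) (++-assoc X Y Z))) bound)
  W-absent  = proj₁ outside
  YZ-absent = proj₂ outside
  Z-absent  = proj₂ (occurrences-++-absent⁻ j Y Z YZ-absent)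
  WY-absent = occurrences-++-absent⁺ j W Y W-absent (proj₁ (occurrences-++-absent⁻ j Y Z YZ-absent))

sigEntry-swap : ∀ j W X Y Z → occurrences j (W ++ (X ++ Y) ++ Z) ≤ 2 → 2 ∣ occurrences j X → 2 ∣ occurrences j Y →
  sigEntry (W ++ (Y ++ X) ++ Z) j ≡ sigEntry (W ++ (X ++ Y) ++ Z) j
sigEntry-swap j W X Y Z bound 2∣x 2∣y with even-zero-or-≥2 2∣x | even-zero-or-≥2 2∣y
... | inj₂ 2≤x | _        = sigEntry-swap-holding j W X Y Z 2≤x bound
... | inj₁ _   | inj₂ 2≤y = sym (sigEntry-swap-holding j W Y X Z 2≤y (subst (_≤ 2) (sym (occurrences-swap j W X Y Z)) bound))
... | inj₁ x≡0 | inj₁ y≡0 = sigEntry-positions (W ++ (Y ++ X) ++ Z) (W ++ (X ++ Y) ++ Z) j (begin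
  positionsFrom j 0 (W ++ (Y ++ X) ++ Z)
    ≡⟨ positionsFrom-skip j 0 W (Y ++ X) Z (occurrences-++-absent⁺ j Y X y≡0 x≡0) ⟩
  positionsFrom j 0 W ++ positionsFrom j (length W + length (Y ++ X)) Z
    ≡⟨ cong (λ n → positionsFrom j 0 W ++ positionsFrom j (length W + n) Z) (length-++-comm Y X) ⟩
  positionsFrom j 0 W ++ positionsFrom j (length W + length (X ++ Y)) Z
    ≡⟨ positionsFrom-skip j 0 W (X ++ Y) Z (occurrences-++-absent⁺ j X Y x≡0 y≡0) ⟨
  positionsFrom j 0 (W ++ (X ++ Y) ++ Z)
    ∎)
  where open ≡-Reasoning

-- Nests as forests

data Tree : Set where
  node : ℕ → List Tree → Tree

root : Tree → ℕ
root (node r _) = r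

roots : List Tree → List ℕ
roots = map root

mutual
  flatten : Tree → List ℕ
  flatten (node r ts) = r ∷ flattenForest ts ++ r ∷ []

  flattenForest : List Tree → List ℕ
  flattenForest []       = []
  flattenForest (t ∷ ts) = flatten t ++ flattenForest ts

mutual
  size : Tree → ℕ
  size (node _ ts) = suc (sizeForest ts)

  sizeForest : List Tree → ℕ
  sizeForest []       = 0
  sizeForest (t ∷ ts) = size t + sizeForest ts

flattenForest-∷ʳ : ∀ ts t → flattenForest (ts ∷ʳ t) ≡ flattenForest ts ++ flatten t
flattenForest-∷ʳ []       t = ++-identityʳ (flatten t)
flattenForest-∷ʳ (u ∷ ts) t = trans (cong (flatten u ++_) (flattenForest-∷ʳ ts t)) (sym (++-assoc (flatten u) _ _))

sizeForest-∷ʳ : ∀ ts t → sizeForest (ts ∷ʳ t) ≡ sizeForest ts + size t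
sizeForest-∷ʳ []       t = +-identityʳ (size t)
sizeForest-∷ʳ (u ∷ ts) t = trans (cong (size u +_) (sizeForest-∷ʳ ts t)) (sym (+-assoc (size u) _ _))

size-positive : ∀ t → 0 < size t
size-positive (node _ _) = s≤s z≤n

mutual
  length-flatten : ∀ t → length (flatten t) ≡ size t + size t
  length-flatten (node r ts) = cong suc (begin
    length (flattenForest ts ++ r ∷ [])  ≡⟨ length-++ (flattenForest ts) ⟩
    length (flattenForest ts) + 1        ≡⟨ cong (_+ 1) (length-flattenForest ts) ⟩
    sizeForest ts + sizeForest ts + 1    ≡⟨ solve 1 (λ n → n :+ n :+ con 1 := n :+ (con 1 :+ n)) refl (sizeForest ts) ⟩
    sizeForest ts + suc (sizeForest ts)  ∎)
    where open ≡-Reasoning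

  length-flattenForest : ∀ ts → length (flattenForest ts) ≡ sizeForest ts + sizeForest ts
  length-flattenForest []       = refl
  length-flattenForest (t ∷ ts) = begin
    length (flatten t ++ flattenForest ts)           ≡⟨ length-++ (flatten t) ⟩
    length (flatten t) + length (flattenForest ts)   ≡⟨ cong₂ _+_ (length-flatten t) (length-flattenForest ts) ⟩
    (size t + size t) + (sizeForest ts + sizeForest ts)
      ≡⟨ solve 2 (λ a b → (a :+ a) :+ (b :+ b) := (a :+ b) :+ (a :+ b)) refl (size t) (sizeForest ts) ⟩
    (size t + sizeForest ts) + (size t + sizeForest ts) ∎
    where open ≡-Reasoning

mutual
  occurrences-flatten-even : ∀ j t → 2 ∣ occurrences j (flatten t)
  occurrences-flatten-even j (node r ts) = subst (2 ∣_) (sym count)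
      (∣m∣n⇒∣m+n (occurrences-flattenForest-even j ts) (n∣m*n c))
    where
    c = occurrences j (r ∷ [])
    f = occurrences j (flattenForest ts)
    count : occurrences j (flatten (node r ts)) ≡ f + c * 2
    count = begin
      occurrences j (r ∷ flattenForest ts ++ r ∷ [])  ≡⟨ occurrences-++ j (r ∷ []) _ ⟩
      c + occurrences j (flattenForest ts ++ r ∷ [])  ≡⟨ cong (c +_) (occurrences-++ j (flattenForest ts) _) ⟩
      c + (f + c)                                     ≡⟨ solve 2 (λ c f → c :+ (f :+ c) := f :+ c :* con 2) refl c f ⟩
      f + c * 2                                       ∎
      where open ≡-Reasoning

  occurrences-flattenForest-even : ∀ j ts → 2 ∣ occurrences j (flattenForest ts)
  occurrences-flattenForest-even j []       = 2 ∣0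
  occurrences-flattenForest-even j (t ∷ ts) = subst (2 ∣_) (sym (occurrences-++ j (flatten t) _))
    (∣m∣n⇒∣m+n (occurrences-flatten-even j t) (occurrences-flattenForest-even j ts))

occurrences-root : ∀ t → 2 ≤ occurrences (root t) (flatten t)
occurrences-root (node r ts) = subst (2 ≤_) (sym count) (s≤s (s≤s z≤n))
  where
  count : occurrences r (flatten (node r ts)) ≡ 2 + occurrences r (flattenForest ts)
  count = begin
    occurrences r (r ∷ flattenForest ts ++ r ∷ [])      ≡⟨ occurrences-here r _ ⟩
    suc (occurrences r (flattenForest ts ++ r ∷ []))     ≡⟨ cong suc (occurrences-++ r (flattenForest ts) _) ⟩
    suc (occurrences r (flattenForest ts) + occurrences r (r ∷ []))
      ≡⟨ cong (λ n → suc (occurrences r (flattenForest ts) + n)) (occurrences-here r []) ⟩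
    suc (occurrences r (flattenForest ts) + 1)           ≡⟨ cong suc (+-comm _ 1) ⟩
    2 + occurrences r (flattenForest ts)                 ∎
    where open ≡-Reasoning

countdown : ℕ → ℕ → List ℕ
countdown lo zero    = []
countdown lo (suc n) = lo + n ∷ countdown lo n

countdown-∷ʳ : ∀ lo n → countdown (suc lo) n ∷ʳ lo ≡ countdown lo (suc n)
countdown-∷ʳ lo zero    = cong (_∷ []) (sym (+-identityʳ lo))
countdown-∷ʳ lo (suc n) = cong₂ _∷_ (sym (+-suc lo n)) (countdown-∷ʳ lo n)

length-countdown : ∀ lo n → length (countdown lo n) ≡ n
length-countdown lo zero    = refl
length-countdown lo (suc n) = cong suc (length-countdown lo n)

occurrences-countdown-absent : ∀ lo n x → lo + n ≤ x → occurrences x (countdown lo n) ≡ 0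
occurrences-countdown-absent lo zero    x _   = refl
occurrences-countdown-absent lo (suc n) x le =
  trans (occurrences-there (countdown lo n) (<⇒≢ (≤-trans (≤-reflexive (sym (+-suc lo n))) le)))
        (occurrences-countdown-absent lo n x (≤-trans (+-monoʳ-≤ lo (n≤1+n n)) le))

occurrences-countdown-≤1 : ∀ lo n x → occurrences x (countdown lo n) ≤ 1
occurrences-countdown-≤1 lo zero    x = z≤n
occurrences-countdown-≤1 lo (suc n) x with lo + n ≟ x
... | yes refl = s≤s (≤-reflexive (occurrences-countdown-absent lo n (lo + n) ≤-refl))
... | no  _    = occurrences-countdown-≤1 lo n x

occurrences-upTo-absent : ∀ n x → n ≤ x → occurrences x (upTo n) ≡ 0
occurrences-upTo-absent zero    x _  = refl
occurrences-upTo-absent (suc n) x le = begin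
  occurrences x (upTo (suc n))                ≡⟨ cong (occurrences x) (upTo-∷ʳ n) ⟨
  occurrences x (upTo n ∷ʳ n)                 ≡⟨ occurrences-++ x (upTo n) _ ⟩
  occurrences x (upTo n) + occurrences x (n ∷ [])
    ≡⟨ cong₂ _+_ (occurrences-upTo-absent n x (≤-trans (n≤1+n n) le)) (occurrences-there [] (<⇒≢ le)) ⟩
  0                                           ∎
  where open ≡-Reasoning

occurrences-upTo-≤1 : ∀ n x → occurrences x (upTo n) ≤ 1
occurrences-upTo-≤1 zero    x = z≤n
occurrences-upTo-≤1 (suc n) x =
  subst (_≤ 1) (trans (sym (occurrences-++ x (upTo n) (n ∷ []))) (cong (occurrences x) (upTo-∷ʳ n))) (last (n ≟ x))
  where
  last : Dec (n ≡ x) → occurrences x (upTo n) + occurrences x (n ∷ []) ≤ 1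
  last (yes refl) rewrite occurrences-upTo-absent n n ≤-refl | occurrences-here n [] = ≤-refl
  last (no  n≢x)  rewrite occurrences-there {x} [] n≢x | +-identityʳ (occurrences x (upTo n)) = occurrences-upTo-≤1 n x

rootNest≡ : ∀ k → rootNest k ≡ upTo (suc k) ++ countdown 1 k
rootNest≡ zero    = refl
rootNest≡ (suc k) = cong (λ ns → upTo (suc (suc k)) ++ suc k ∷ ns) (++-cancelˡ (upTo (suc k)) _ _ (rootNest≡ k))

at-most-twice-rootNest : ∀ k → AtMostTwice (rootNest k)
at-most-twice-rootNest k x =
  subst (_≤ 2) (sym (trans (cong (occurrences x) (rootNest≡ k)) (occurrences-++ x (upTo (suc k)) _)))
        (+-mono-≤ (occurrences-upTo-≤1 (suc k) x) (occurrences-countdown-≤1 1 k x))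

-- The step as a block exchange

-- headOrZero and rotate make visible what step computes with its local helper.
headOrZero : List ℕ → ℕ
headOrZero []      = 0
headOrZero (x ∷ _) = x

rotate : List ℕ → List ℕ → List ℕ → List ℕ
rotate W M Z = W ++ proj₂ (splitAt≡ (suc (headOrZero M)) M) ++ proj₁ (splitAt≡ (suc (headOrZero M)) M) ++ Z

step≡rotate : ∀ i N → step i N ≡ rotate (take i N) (take (length N ∸ (i + i)) (drop i N)) (drop (length N ∸ i) N)
step≡rotate i N with take (length N ∸ (i + i)) (drop i N)
... | []    = refl
... | _ ∷ _ = refl

take-length-++ : ∀ (xs ys : List ℕ) → take (length xs) (xs ++ ys) ≡ xs
take-length-++ []       ys = refl
take-length-++ (x ∷ xs) ys = cong (x ∷_) (take-length-++ xs ys)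

drop-length-++ : ∀ (xs ys : List ℕ) → drop (length xs) (xs ++ ys) ≡ ys
drop-length-++ []       ys = refl
drop-length-++ (x ∷ xs) ys = drop-length-++ xs ys

step-++ : ∀ W M Z → length Z ≡ length W → step (length W) (W ++ M ++ Z) ≡ rotate W M Z
step-++ W M Z |Z|≡|W| = begin
  step w (W ++ M ++ Z)
    ≡⟨ step≡rotate w (W ++ M ++ Z) ⟩
  rotate (take w (W ++ M ++ Z)) (take (|N| ∸ (w + w)) (drop w (W ++ M ++ Z))) (drop (|N| ∸ w) (W ++ M ++ Z))
    ≡⟨ cong₂ (λ A B → rotate A B (drop (|N| ∸ w) (W ++ M ++ Z))) (take-length-++ W _) middle ⟩
  rotate W M (drop (|N| ∸ w) (W ++ M ++ Z))
    ≡⟨ cong (rotate W M) right ⟩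
  rotate W M Z
    ∎
  where
  open ≡-Reasoning
  w = length W
  m = length M
  |N| = length (W ++ M ++ Z)
  |N|≡ : |N| ≡ w + (m + w)
  |N|≡ = trans (length-++ W) (cong (w +_) (trans (length-++ M) (cong (m +_) |Z|≡|W|)))
  middle : take (|N| ∸ (w + w)) (drop w (W ++ M ++ Z)) ≡ M
  middle = trans (cong₂ take |M|≡ (drop-length-++ W (M ++ Z))) (take-length-++ M Z)
    where
    |M|≡ : |N| ∸ (w + w) ≡ m
    |M|≡ = trans (cong (_∸ (w + w)) (trans |N|≡ (solve 2 (λ w m → w :+ (m :+ w) := (w :+ w) :+ m) refl w m)))
                 (m+n∸m≡n (w + w) m)
  right : drop (|N| ∸ w) (W ++ M ++ Z) ≡ Z
  right = trans (cong₂ drop |WM|≡ (sym (++-assoc W M Z))) (drop-length-++ (W ++ M) Z)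
    where
    |WM|≡ : |N| ∸ w ≡ length (W ++ M)
    |WM|≡ = trans (cong (_∸ w) (trans |N|≡ (sym (+-assoc w m w)))) (trans (m+n∸n≡m (w + m) w) (sym (length-++ W)))

splitAt≡-first : ∀ d P Q → occurrences d P ≡ 0 → splitAt≡ d (P ++ d ∷ Q) ≡ (P , d ∷ Q)
splitAt≡-first d []      Q _ with d ≟ d
... | yes _   = refl
... | no  d≢d = ⊥-elim (d≢d refl)
splitAt≡-first d (x ∷ P) Q absent with x ≟ d
splitAt≡-first d (x ∷ P) Q () | yes _
... | no _ rewrite splitAt≡-first d P Q absent = refl

step-exchange : ∀ W P Y Z → length Z ≡ length W → headOrZero Y ≡ suc (headOrZero (P ++ Y)) →
  occurrences (headOrZero Y) P ≡ 0 →
  step (length W) (W ++ (P ++ Y) ++ Z) ≡ W ++ (Y ++ P) ++ Z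
step-exchange W P []      Z _       ()
step-exchange W P (y ∷ Y) Z |Z|≡|W| y≡ absent = begin
  step (length W) (W ++ (P ++ y ∷ Y) ++ Z)  ≡⟨ step-++ W (P ++ y ∷ Y) Z |Z|≡|W| ⟩
  rotate W (P ++ y ∷ Y) Z                  ≡⟨ cong (λ p → W ++ proj₂ p ++ proj₁ p ++ Z) split ⟩
  W ++ (y ∷ Y) ++ P ++ Z                   ≡⟨ cong (W ++_) (++-assoc (y ∷ Y) P Z) ⟨
  W ++ ((y ∷ Y) ++ P) ++ Z                 ∎
  where
  open ≡-Reasoning
  split : splitAt≡ (suc (headOrZero (P ++ y ∷ Y))) (P ++ y ∷ Y) ≡ (P , y ∷ Y)
  split = subst (λ d → splitAt≡ d (P ++ y ∷ Y) ≡ (P , y ∷ Y)) y≡ (splitAt≡-first y P Y absent)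

-- Stages of the construction

-- At level i = 1 + j, after s steps with r further steps possible, the nest reads
--   0 1 ⋯ j | T₁ ⋯ T_s i H₁ ⋯ H_r | i ⋯ 2 1
-- with the trees T rooted at i + s, …, i + 1 and the trees H at i + s + r, …, i + s + 1;
-- a step moves H_r to the front of the T's.
record Stage (j s r : ℕ) (N : List ℕ) : Set where
  constructor stage
  field
    moved hanging : List Tree
    shape         : N ≡ upTo (suc j) ++ (flattenForest moved ++ suc j ∷ flattenForest hanging) ++ countdown 1 (suc j)
    roots-moved   : roots moved ≡ countdown (suc (suc j)) s
    roots-hanging : roots hanging ≡ countdown (suc s + suc j) r
    at-most-twice : AtMostTwice N

sigEntry-stage : ∀ {j s r N} (st : Stage j s r N) → sigEntry N (suc j) ≡ sizeForest (Stage.hanging st)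
sigEntry-stage {j} {N = N} (stage Ts H N≡ _ _ twice) = begin
  sigEntry N i                                   ≡⟨ cong (λ M → sigEntry M i) N≡′ ⟩
  sigEntry (P ++ i ∷ flattenForest H ++ i ∷ C) i  ≡⟨ sigEntry-between i P (flattenForest H) C (proj₁ absent) (proj₂ absent) ⟩
  suc (length (flattenForest H)) / 2             ≡⟨ cong (λ n → suc n / 2) (length-flattenForest H) ⟩
  suc (sizeForest H + sizeForest H) / 2          ≡⟨ [1+n+n]/2≡n (sizeForest H) ⟩
  sizeForest H                                   ∎
  where
  open ≡-Reasoning
  i = suc j
  P = upTo i ++ flattenForest Ts
  C = countdown 1 j
  N≡′ : N ≡ P ++ i ∷ flattenForest H ++ i ∷ C
  N≡′ = trans N≡ (trans (cong (upTo i ++_) (++-assoc (flattenForest Ts) (i ∷ flattenForest H) (i ∷ C)))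
                        (sym (++-assoc (upTo i) (flattenForest Ts) _)))
  absent = occurrences-between i P (flattenForest H) C (subst (λ M → occurrences i M ≤ 2) N≡′ (twice i))

head-stage : ∀ i s Ts rest → roots Ts ≡ countdown (suc i) s → headOrZero (flattenForest Ts ++ i ∷ rest) ≡ s + i
head-stage i zero    []                rest _  = refl
head-stage i (suc s) (node a _ ∷ _)   rest eq = trans (∷-injectiveˡ eq) (cong suc (+-comm i s))

step-moves-tree : ∀ i s Ts H′ t N →
  N ≡ upTo i ++ ((flattenForest Ts ++ i ∷ flattenForest H′) ++ flatten t) ++ countdown 1 i →
  roots Ts ≡ countdown (suc i) s → root t ≡ suc s + i → occurrences (root t) N ≤ 2 →
  step i N ≡ upTo i ++ (flatten t ++ flattenForest Ts ++ i ∷ flattenForest H′) ++ countdown 1 i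
step-moves-tree i s Ts H′ t@(node a _) N N≡ rTs a≡ bound = begin
  step i N                               ≡⟨ cong (step i) N≡ ⟩
  step i (W ++ (P ++ Y) ++ Z)            ≡⟨ cong (λ n → step n (W ++ (P ++ Y) ++ Z)) (length-upTo i) ⟨
  step (length W) (W ++ (P ++ Y) ++ Z)   ≡⟨ step-exchange W P Y Z (trans (length-countdown 1 i) (sym (length-upTo i))) head≡ P-absent ⟩
  W ++ (Y ++ P) ++ Z                     ∎
  where
  open ≡-Reasoning
  W = upTo i
  Z = countdown 1 i
  P = flattenForest Ts ++ i ∷ flattenForest H′
  Y = flatten t
  head≡ : a ≡ suc (headOrZero (P ++ Y))
  head≡ = trans a≡ (cong suc (sym (trans (cong headOrZero (++-assoc (flattenForest Ts) _ Y)) (head-stage i s Ts _ rTs))))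
  P-absent : occurrences a P ≡ 0
  P-absent = proj₂ (occurrences-++-absent⁻ a W P (proj₁ (occurrences-outside a (W ++ P) Y Z (occurrences-root t)
    (subst (λ M → occurrences a M ≤ 2) (trans N≡ (trans (cong (W ++_) (++-assoc P Y Z)) (sym (++-assoc W P _)))) bound))))

stage-step : ∀ {j s r N} → Stage j s (suc r) N →
  Stage j (suc s) r (step (suc j) N) ×
  sigEntry (step (suc j) N) (suc j) < sigEntry N (suc j) ×
  (∀ l → suc j < l → sigEntry (step (suc j) N) l ≡ sigEntry N l)
stage-step {j} {s} {r} {N} st@(stage Ts H N≡ rTs rH twice) with initLast H
... | H′ ∷ʳ′ t = stage′ , decreases , preserves
  where
  i = suc j
  W = upTo i
  Z = countdown 1 i
  P = flattenForest Ts ++ i ∷ flattenForest H′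
  Y = flatten t
  roots≡ : roots H′ ≡ countdown (suc (suc s + i)) r × root t ≡ suc s + i
  roots≡ = ∷ʳ-injective (roots H′) _ (trans (sym (map-++ root H′ (t ∷ []))) (trans rH (sym (countdown-∷ʳ (suc s + i) r))))
  N≡WPYZ : N ≡ W ++ (P ++ Y) ++ Z
  N≡WPYZ = trans N≡ (cong (λ M → W ++ M ++ Z)
    (trans (cong (λ F → flattenForest Ts ++ i ∷ F) (flattenForest-∷ʳ H′ t)) (sym (++-assoc (flattenForest Ts) _ Y))))
  bound : ∀ x → occurrences x (W ++ (P ++ Y) ++ Z) ≤ 2
  bound x = subst (λ M → occurrences x M ≤ 2) N≡WPYZ (twice x)
  step≡ : step i N ≡ W ++ (Y ++ P) ++ Z
  step≡ = step-moves-tree i s Ts H′ t N N≡WPYZ rTs (proj₂ roots≡) (twice (root t))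
  stage′ : Stage j (suc s) r (step i N)
  stage′ = stage (t ∷ Ts) H′
    (trans step≡ (cong (λ M → W ++ M ++ Z) (sym (++-assoc Y (flattenForest Ts) _))))
    (cong₂ _∷_ (trans (proj₂ roots≡) (cong suc (+-comm s i))) rTs)
    (proj₁ roots≡)
    (λ x → subst (_≤ 2) (sym (trans (cong (occurrences x) step≡) (occurrences-swap x W P Y Z))) (bound x))
  decreases : sigEntry (step i N) i < sigEntry N i
  decreases = subst₂ _<_ (sym (sigEntry-stage stage′)) (sym (sigEntry-stage st))
    (subst (sizeForest H′ <_) (sym (sizeForest-∷ʳ H′ t)) (m<m+n (sizeForest H′) (size-positive t)))
  preserves : ∀ l → i < l → sigEntry (step i N) l ≡ sigEntry N l
  preserves l i<l = trans (cong (λ M → sigEntry M l) step≡)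
    (trans (sigEntry-swap l W P Y Z (bound l) P-even (occurrences-flatten-even l t))
           (cong (λ M → sigEntry M l) (sym N≡WPYZ)))
    where
    P-even : 2 ∣ occurrences l P
    P-even = subst (2 ∣_)
      (sym (trans (occurrences-++ l (flattenForest Ts) _) (cong (occurrences l (flattenForest Ts) +_) (occurrences-there _ (<⇒≢ i<l)))))
      (∣m∣n⇒∣m+n (occurrences-flattenForest-even l Ts) (occurrences-flattenForest-even l H′))

stage-fold : ∀ {j s} d {r N} → Stage j s (d + r) N → Stage j (s + d) r (fold N (step (suc j)) d)
stage-fold {j} {s} zero    {r} {N} st = subst (λ s′ → Stage j s′ r N) (sym (+-identityʳ s)) st
stage-fold {j} {s} (suc d) {r} {N} st = subst (λ s′ → Stage j s′ r (fold N (step (suc j)) (suc d))) (sym (+-suc s d))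
  (proj₁ (stage-step (stage-fold d (subst (λ r′ → Stage j s r′ N) (sym (+-suc d r)) st))))

sigEntry-fold-decreasing : ∀ {j s} d {r N} → Stage j s (d + r) N →
  sigEntry (fold N (step (suc j)) d) (suc j) + d ≤ sigEntry N (suc j)
sigEntry-fold-decreasing zero            st = ≤-reflexive (+-identityʳ _)
sigEntry-fold-decreasing {j} {s} (suc d) {r} {N} st = begin
  sigEntry (step i (fold N (step i) d)) i + suc d   ≡⟨ +-suc _ d ⟩
  suc (sigEntry (step i (fold N (step i) d)) i) + d ≤⟨ +-monoˡ-≤ d (proj₁ (proj₂ (stage-step (stage-fold d st′)))) ⟩
  sigEntry (fold N (step i) d) i + d                ≤⟨ sigEntry-fold-decreasing d st′ ⟩
  sigEntry N i                                      ∎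
  where
  open ≤-Reasoning
  i = suc j
  st′ = subst (λ r′ → Stage j s r′ N) (sym (+-suc d r)) st

sigEntry-fold-above : ∀ {j s} d {r N} → Stage j s (d + r) N →
  ∀ l → suc j < l → sigEntry (fold N (step (suc j)) d) l ≡ sigEntry N l
sigEntry-fold-above zero                 st l _   = refl
sigEntry-fold-above {j} {s} (suc d) {r} {N} st l j<l =
  trans (proj₂ (proj₂ (stage-step (stage-fold d st′))) l j<l) (sigEntry-fold-above d st′ l j<l)
  where st′ = subst (λ r′ → Stage j s r′ N) (sym (+-suc d r)) st

sigEntry-fold-< : ∀ {j r N x y} → Stage j 0 r N → x < y → y ≤ r →
  sigEntry (fold N (step (suc j)) y) (suc j) < sigEntry (fold N (step (suc j)) x) (suc j)
sigEntry-fold-< {j} {r} {N} {x} {y} st x<y y≤r = begin-strict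
  sigEntry (fold N f y) i                       ≡⟨ cong (λ M → sigEntry M i) fold-y ⟩
  sigEntry (fold (fold N f x) f d) i            <⟨ m<m+n _ (m<n⇒0<n∸m x<y) ⟩
  sigEntry (fold (fold N f x) f d) i + d        ≤⟨ sigEntry-fold-decreasing d (stage-fold x st′) ⟩
  sigEntry (fold N f x) i                       ∎
  where
  open ≤-Reasoning
  i = suc j
  f = step i
  d = y ∸ x
  fold-y : fold N f y ≡ fold (fold N f x) f d
  fold-y = trans (cong (fold N f) (sym (m∸n+n≡m (<⇒≤ x<y)))) (fold-+ N f d)
  r≡ : r ≡ x + (d + (r ∸ y))
  r≡ = sym (trans (sym (+-assoc x d _)) (trans (cong (_+ (r ∸ y)) (m+[n∸m]≡n (<⇒≤ x<y))) (m+[n∸m]≡n y≤r)))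
  st′ : Stage j 0 (x + (d + (r ∸ y))) N
  st′ = subst (λ r′ → Stage j 0 r′ N) r≡ st

sigEntry-fold-injective : ∀ {j r N x y} → Stage j 0 r N → x ≤ r → y ≤ r →
  sigEntry (fold N (step (suc j)) x) (suc j) ≡ sigEntry (fold N (step (suc j)) y) (suc j) → x ≡ y
sigEntry-fold-injective {x = x} {y} st x≤r y≤r eq with <-cmp x y
... | tri< x<y _ _ = ⊥-elim (<-irrefl (sym eq) (sigEntry-fold-< st x<y y≤r))
... | tri≈ _ x≡y _ = x≡y
... | tri> _ _ y<x = ⊥-elim (<-irrefl eq (sigEntry-fold-< st y<x x≤r))

stage-descend : ∀ {j s r N} → Stage (suc j) s r N → Stage j 0 (suc s) N
stage-descend {j} {s} (stage Ts H N≡ rTs _ twice) =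
  stage [] (Ts ∷ʳ node k H) (trans N≡ regroup) refl roots≡ twice
  where
  i = suc j
  k = suc i
  C = countdown 1 i
  roots≡ : roots (Ts ∷ʳ node k H) ≡ countdown k (suc s)
  roots≡ = trans (map-++ root Ts (node k H ∷ [])) (trans (cong (_∷ʳ k) rTs) (countdown-∷ʳ k s))
  regroup : upTo k ++ (flattenForest Ts ++ k ∷ flattenForest H) ++ k ∷ C
          ≡ upTo i ++ (i ∷ flattenForest (Ts ∷ʳ node k H)) ++ C
  regroup = begin
    upTo k ++ (flattenForest Ts ++ k ∷ flattenForest H) ++ k ∷ C
      ≡⟨ cong (_++ (flattenForest Ts ++ k ∷ flattenForest H) ++ k ∷ C) (upTo-∷ʳ i) ⟨
    (upTo i ∷ʳ i) ++ (flattenForest Ts ++ k ∷ flattenForest H) ++ k ∷ C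
      ≡⟨ ++-assoc (upTo i) (i ∷ []) _ ⟩
    upTo i ++ i ∷ (flattenForest Ts ++ k ∷ flattenForest H) ++ k ∷ C
      ≡⟨ cong (λ M → upTo i ++ i ∷ M) (++-assoc (flattenForest Ts) _ _) ⟩
    upTo i ++ i ∷ flattenForest Ts ++ k ∷ flattenForest H ++ k ∷ C
      ≡⟨ cong (λ M → upTo i ++ i ∷ flattenForest Ts ++ k ∷ M) (++-assoc (flattenForest H) (k ∷ []) C) ⟨
    upTo i ++ i ∷ flattenForest Ts ++ flatten (node k H) ++ C
      ≡⟨ cong (λ M → upTo i ++ i ∷ M) (++-assoc (flattenForest Ts) _ C) ⟨
    upTo i ++ i ∷ (flattenForest Ts ++ flatten (node k H)) ++ C
      ≡⟨ cong (λ M → upTo i ++ (i ∷ M) ++ C) (flattenForest-∷ʳ Ts (node k H)) ⟨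
    upTo i ++ (i ∷ flattenForest (Ts ∷ʳ node k H)) ++ C
      ∎
    where open ≡-Reasoning

stage-rootNest : ∀ j → Stage j 0 0 (rootNest (suc j))
stage-rootNest j = stage [] [] shape refl refl (at-most-twice-rootNest (suc j))
  where
  shape : rootNest (suc j) ≡ upTo (suc j) ++ (suc j ∷ []) ++ countdown 1 (suc j)
  shape = trans (rootNest≡ (suc j)) (trans (cong (_++ countdown 1 (suc j)) (sym (upTo-∷ʳ (suc j)))) (++-assoc (upTo (suc j)) _ _))

ChainFrom : ℕ → List ℕ → Set
ChainFrom b []      = ⊤
ChainFrom b (x ∷ α) = x ≤ suc b × ChainFrom x α

-- Unwinding the recursion of F along the tree of germs: F(a_(k-1) ⋯ a_1) is the root nest after
-- a_(k-1) steps at level k - 1, then a_(k-2) steps at level k - 2, and so on.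
apply : List ℕ → List ℕ → List ℕ
apply N []      = N
apply N (x ∷ α) = apply (fold N (step (suc (length α))) x) α

stage-split : ∀ {j b N x} → Stage j 0 (suc b) N → x ≤ suc b → Stage j 0 (x + (suc b ∸ x)) N
stage-split {j} {b} {N} st x≤ = subst (λ r → Stage j 0 r N) (sym (m+[n∸m]≡n x≤)) st

stage-next : ∀ {j b N x} → Stage (suc j) 0 (suc b) N → x ≤ suc b → Stage j 0 (suc x) (fold N (step (suc (suc j))) x)
stage-next {x = x} st x≤ = stage-descend (stage-fold x (stage-split st x≤))

apply-above : ∀ {j b N} x α → length α ≡ j → Stage j 0 (suc b) N → ChainFrom b (x ∷ α) →
  ∀ l → suc j < l → sigEntry (apply N (x ∷ α)) l ≡ sigEntry N l
apply-above x []       refl st (x≤ , _) l i<l = sigEntry-fold-above x (stage-split st x≤) l i<l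
apply-above x (y ∷ α) refl st (x≤ , cy) l i<l =
  trans (apply-above y α refl (stage-next st x≤) cy l (<-trans (n<1+n _) i<l))
        (sigEntry-fold-above x (stage-split st x≤) l i<l)

apply-top : ∀ {j b N} x α → length α ≡ j → Stage j 0 (suc b) N → ChainFrom b (x ∷ α) →
  sigEntry (apply N (x ∷ α)) (suc j) ≡ sigEntry (fold N (step (suc j)) x) (suc j)
apply-top x []       refl st _         = refl
apply-top x (y ∷ α) refl st (x≤ , cy) = apply-above y α refl (stage-next st x≤) cy _ (n<1+n _)

apply-injective : ∀ {j b N} x α y β → length α ≡ j → length β ≡ j → Stage j 0 (suc b) N →
  ChainFrom b (x ∷ α) → ChainFrom b (y ∷ β) →
  (∀ l → 0 < l → l ≤ suc j → sigEntry (apply N (x ∷ α)) l ≡ sigEntry (apply N (y ∷ β)) l) →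
  x ∷ α ≡ y ∷ β
apply-injective x [] y [] refl refl st (x≤ , _) (y≤ , _) agree =
  cong (_∷ []) (sigEntry-fold-injective st x≤ y≤ (agree 1 (s≤s z≤n) ≤-refl))
apply-injective {N = N} x (x′ ∷ α) y (y′ ∷ β) refl lβ st cx@(x≤ , cα) cy@(y≤ , cβ) agree
  with sigEntry-fold-injective st x≤ y≤
         (trans (sym (apply-top x (x′ ∷ α) refl st cx)) (trans (agree _ (s≤s z≤n) ≤-refl) (apply-top y (y′ ∷ β) lβ st cy)))
... | refl = cong (x ∷_) (apply-injective x′ α y′ β refl (suc-injective lβ) (stage-next st x≤) cα cβ agree′)
  where
  M = fold N (step (suc (suc (length α)))) x
  agree′ : ∀ l → 0 < l → l ≤ suc (length α) → sigEntry (apply M (x′ ∷ α)) l ≡ sigEntry (apply M (y′ ∷ β)) l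
  agree′ l 0<l l≤ = trans (agree l 0<l (m≤n⇒m≤1+n l≤)) (cong (λ n → sigEntry (apply (fold N (step (suc n)) x) (y′ ∷ β)) l) lβ)

reverse-replicate : ∀ n (x : ℕ) → reverse (replicate n x) ≡ replicate n x
reverse-replicate zero    x = refl
reverse-replicate (suc n) x = begin
  reverse (x ∷ replicate n x)  ≡⟨ unfold-reverse x (replicate n x) ⟩
  reverse (replicate n x) ∷ʳ x ≡⟨ cong (_∷ʳ x) (reverse-replicate n x) ⟩
  replicate n x ∷ʳ x           ≡⟨ replicate-∷ʳ n ⟩
  x ∷ replicate n x            ∎
  where
  open ≡-Reasoning
  replicate-∷ʳ : ∀ m → replicate m x ∷ʳ x ≡ x ∷ replicate m x
  replicate-∷ʳ zero    = refl
  replicate-∷ʳ (suc m) = cong (x ∷_) (replicate-∷ʳ m)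

reverse-trailing-zeros : ∀ pre y z → reverse (pre ++ y ∷ replicate z 0) ≡ replicate z 0 ++ y ∷ reverse pre
reverse-trailing-zeros pre y z = begin
  reverse (pre ++ y ∷ replicate z 0)             ≡⟨ reverse-++ pre (y ∷ replicate z 0) ⟩
  reverse (y ∷ replicate z 0) ++ reverse pre     ≡⟨ cong (_++ reverse pre) (unfold-reverse y (replicate z 0)) ⟩
  (reverse (replicate z 0) ∷ʳ y) ++ reverse pre  ≡⟨ cong (λ zs → (zs ∷ʳ y) ++ reverse pre) (reverse-replicate z 0) ⟩
  (replicate z 0 ∷ʳ y) ++ reverse pre            ≡⟨ ++-assoc (replicate z 0) (y ∷ []) (reverse pre) ⟩
  replicate z 0 ++ y ∷ reverse pre               ∎
  where open ≡-Reasoning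

rightmostNZ-trailing-zeros : ∀ pre x z → rightmostNZ (pre ++ suc x ∷ replicate z 0) ≡ suc z
rightmostNZ-trailing-zeros pre x z = cong suc (trans (cong leadingZeros (reverse-trailing-zeros pre (suc x) z)) (leading z))
  where
  leading : ∀ n → leadingZeros (replicate n 0 ++ suc x ∷ reverse pre) ≡ n
  leading zero    = refl
  leading (suc n) = cong suc (leading n)

parent-trailing-zeros : ∀ pre x z → parent (pre ++ suc x ∷ replicate z 0) ≡ pre ++ x ∷ replicate z 0
parent-trailing-zeros pre x z = begin
  reverse (decFirst (reverse (pre ++ suc x ∷ replicate z 0)))  ≡⟨ cong (reverse ∘ decFirst) (reverse-trailing-zeros pre (suc x) z) ⟩
  reverse (decFirst (replicate z 0 ++ suc x ∷ reverse pre))    ≡⟨ cong reverse (decrement z) ⟩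
  reverse (replicate z 0 ++ x ∷ reverse pre)                   ≡⟨ cong reverse (reverse-trailing-zeros pre x z) ⟨
  reverse (reverse (pre ++ x ∷ replicate z 0))                 ≡⟨ reverse-involutive _ ⟩
  pre ++ x ∷ replicate z 0                                     ∎
  where
  open ≡-Reasoning
  decrement : ∀ n → decFirst (replicate n 0 ++ suc x ∷ reverse pre) ≡ replicate n 0 ++ x ∷ reverse pre
  decrement zero    = refl
  decrement (suc n) = cong (0 ∷_) (decrement n)

F-suc : ∀ k pre x z → F k (pre ++ suc x ∷ replicate z 0) ≡ step (suc z) (F k (pre ++ x ∷ replicate z 0))
F-suc k pre x z = begin
  nestAux k (sum α) α                     ≡⟨ cong (λ n → nestAux k n α) sum≡ ⟩
  nestAux k (suc (sum β)) α
    ≡⟨ cong₂ (λ i γ → step i (nestAux k (sum β) γ)) (rightmostNZ-trailing-zeros pre x z) (parent-trailing-zeros pre x z) ⟩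
  step (suc z) (nestAux k (sum β) β)      ∎
  where
  open ≡-Reasoning
  α = pre ++ suc x ∷ replicate z 0
  β = pre ++ x ∷ replicate z 0
  sum≡ : sum α ≡ suc (sum β)
  sum≡ = trans (sum-++ pre _) (trans (+-suc (sum pre) _) (cong suc (sym (sum-++ pre _))))

F-fold : ∀ k pre x z → F k (pre ++ x ∷ replicate z 0) ≡ fold (F k (pre ++ replicate (suc z) 0)) (step (suc z)) x
F-fold k pre zero    z = refl
F-fold k pre (suc x) z = trans (F-suc k pre x z) (cong (step (suc z)) (F-fold k pre x z))

F-++ : ∀ k pre α → F k (pre ++ α) ≡ apply (F k (pre ++ replicate (length α) 0)) α
F-++ k pre []      = refl
F-++ k pre (x ∷ α) = begin
  F k (pre ++ x ∷ α)                                                 ≡⟨ cong (F k) (++-assoc pre (x ∷ []) α) ⟨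
  F k ((pre ∷ʳ x) ++ α)                                              ≡⟨ F-++ k (pre ∷ʳ x) α ⟩
  apply (F k ((pre ∷ʳ x) ++ replicate (length α) 0)) α               ≡⟨ cong (λ M → apply M α) start ⟩
  apply (fold (F k (pre ++ replicate (suc (length α)) 0)) (step (suc (length α))) x) α ∎
  where
  open ≡-Reasoning
  start = trans (cong (F k) (++-assoc pre (x ∷ []) (replicate (length α) 0))) (F-fold k pre x (length α))

F≡apply : ∀ k α → F k α ≡ apply (rootNest k) α
F≡apply k α = trans (F-++ k [] α) (cong (λ n → apply (nestAux k n (replicate (length α) 0)) α) (sum-zeros (length α)))
  where
  sum-zeros : ∀ n → sum (replicate n 0) ≡ 0
  sum-zeros zero    = refl
  sum-zeros (suc n) = sum-zeros n

signature≡ : ∀ k N → signature k N ≡ map (sigEntry N) (countdown 1 (k ∸ 1))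
signature≡ zero          N = refl
signature≡ (suc zero)    N = refl
signature≡ (suc (suc k)) N = cong (sigEntry N (suc k) ∷_) (signature≡ (suc k) N)

map-countdown-agree : ∀ n (f g : ℕ → ℕ) → map f (countdown 1 n) ≡ map g (countdown 1 n) →
  ∀ l → 0 < l → l ≤ n → f l ≡ g l
map-countdown-agree zero    f g eq zero    () _
map-countdown-agree zero    f g eq (suc l) _  ()
map-countdown-agree (suc n) f g eq l 0<l l≤ with m≤n⇒m<n∨m≡n l≤
... | inj₂ refl      = proj₁ (∷-injective eq)
... | inj₁ (s≤s l≤n) = map-countdown-agree n f g (proj₂ (∷-injective eq)) l 0<l l≤n

signature-agree : ∀ k N N′ → signature k N ≡ signature k N′ → ∀ l → 0 < l → l ≤ k ∸ 1 → sigEntry N l ≡ sigEntry N′ l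
signature-agree k N N′ eq =
  map-countdown-agree (k ∸ 1) (sigEntry N) (sigEntry N′) (trans (sym (signature≡ k N)) (trans eq (signature≡ k N′)))

chainFrom-germ : ∀ {x α} → HeadOK (x ∷ α) → Chain (x ∷ α) → ChainFrom 0 (x ∷ α)
chainFrom-germ {x} {α} x≤1 chain = x≤1 , tail x α chain
  where
  tail : ∀ y β → Chain (y ∷ β) → ChainFrom y β
  tail y []      _             = _
  tail y (z ∷ β) (z≤1+y , rest) = z≤1+y , tail z β rest

theorem7 : (k : ℕ) → 2 ≤ k → (α β : List ℕ) → IsGerm k α → IsGerm k β →
    signature k (F k α) ≡ signature k (F k β) → F k α ≡ F k β
theorem7 (suc zero)    (s≤s ()) _ _ _ _ _
theorem7 (suc (suc m)) _ []      _       (() , _) _        _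
theorem7 (suc (suc m)) _ _       []      _        (() , _) _
theorem7 (suc (suc m)) _ (x ∷ α) (y ∷ β) (lα , hα , cα) (lβ , hβ , cβ) sig≡ = cong (F k)
  (apply-injective x α y β (suc-injective lα) (suc-injective lβ) (stage-descend (stage-rootNest (suc m)))
    (chainFrom-germ hα cα) (chainFrom-germ hβ cβ) agree)
  where
  k = suc (suc m)
  agree : ∀ l → 0 < l → l ≤ suc m → sigEntry (apply (rootNest k) (x ∷ α)) l ≡ sigEntry (apply (rootNest k) (y ∷ β)) l
  agree l 0<l l≤ = subst₂ (λ N N′ → sigEntry N l ≡ sigEntry N′ l) (F≡apply k (x ∷ α)) (F≡apply k (y ∷ β))
    (signature-agree k (F k (x ∷ α)) (F k (y ∷ β)) sig≡ l 0<l l≤)
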